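{- Let $p$ be a positive integer, let $T$ be a tree and let $H$ be a connected graph with at least $p$ vertices. Let $V\subseteq V(T(H))$ with $|OC(T,V)|\ge p$ and $V(T)\setminus OC(T,V)\ne\emptyset$. Then $T(H)$ has a matching of size $p$ each edge of which has one end in $V$ and the other end outside $V$.
   Context: For a tree $T$ and a graph $H$ with $V(H)=\{1,\dots,m\}$, $T(H)$ is the disjoint union of copies $H^w$ ($w\in V(T)$) of $H$, with $w^i$ the copy of $i$ in $H^w$, plus the edges $\{w^i,z^i\}$ for every $i$ and every edge $\{w,z\}$ of $T$. $OC(T,V)$ is the set of $w\in V(T)$ with $V(H^w)\cap V\ne\emptyset$. -}

module Defs where

open import Level using (0ℓ)
open import Data.Nat using (ℕ; _≤_)
open import Data.Fin using (Fin)
open import Data.Product using (_×_; Σ; ∃; _,_; proj₁; proj₂)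
open import Data.Sum using (_⊎_)
open import Data.Bool using (Bool; true; false)
open import Data.List using (List; []; _∷_; length; _∷ʳ_)
open import Data.List.Relation.Unary.Linked using (Linked)
open import Data.List.Relation.Unary.Unique.Propositional using (Unique)
open import Relation.Binary.PropositionalEquality using (_≡_; _≢_)
open import Relation.Nullary using (¬_)

record Graph : Set₁ where
  field
    n     : ℕ
    Adj   : Fin n → Fin n → Set
    sym   : ∀ {u v} → Adj u v → Adj v u
    irrefl : ∀ {u} → ¬ Adj u u

open Graph public

data Walk (G : Graph) : Fin (n G) → Fin (n G) → Set where
  here : ∀ {u} → Walk G u u
  step : ∀ {u v w} → Adj G u v → Walk G v w → Walk G u w

Connected : Graph → Set
Connected G = ∀ u v → Walk G u v

IsCycle : (G : Graph) → Fin (n G) → List (Fin (n G)) → Set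
IsCycle G v vs = (2 ≤ length vs) × Unique (v ∷ vs) × Linked (Adj G) ((v ∷ vs) ∷ʳ v)

Acyclic : Graph → Set
Acyclic G = ∀ v vs → ¬ IsCycle G v vs

IsTree : Graph → Set
IsTree G = Connected G × Acyclic G

-- Vertices of T(H): pairs (w , i) standing for w^i.
VT : Graph → Graph → Set
VT T H = Fin (n T) × Fin (n H)

AdjTH : (T H : Graph) → VT T H → VT T H → Set
AdjTH T H (w , i) (z , j) = (w ≡ z × Adj H i j) ⊎ (i ≡ j × Adj T w z)

VSub : Graph → Graph → Set
VSub T H = VT T H → Bool

InV : (T H : Graph) → VT T H → VSub T H → Set
InV T H x V = V x ≡ true

InOC : (T H : Graph) → Fin (n T) → VSub T H → Set
InOC T H w V = ∃ λ (i : Fin (n H)) → InV T H (w , i) V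

OCatLeast : (T H : Graph) → ℕ → VSub T H → Set
OCatLeast T H p V =
  Σ (Fin p → Fin (n T)) λ f → (∀ k l → f k ≡ f l → k ≡ l) × (∀ k → InOC T H (f k) V)

Disjoint : ∀ {A : Set} → A × A → A × A → Set
Disjoint (a , b) (c , d) = a ≢ c × a ≢ d × b ≢ c × b ≢ d

CrossMatching : (T H : Graph) → VSub T H → ℕ → Set
CrossMatching T H V p =
  Σ (Fin p → VT T H × VT T H) λ e →
    (∀ k → AdjTH T H (proj₁ (e k)) (proj₂ (e k)))
    × (∀ k → InV T H (proj₁ (e k)) V)
    × (∀ k → ¬ (InV T H (proj₂ (e k)) V))
    × (∀ k l → k ≢ l → Disjoint (e k) (e l))

module Submission where

-- Call a vertex i of H a colour; the vertices w^i
-- (w ∈ V(T)) form the layer of colour i, a copy of T.  Either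
--   (a) some colour i₀ misses V entirely, or
--   (b) every colour meets V.
-- In case (a), each of the p occupied copies H^w contains a vertex of V
-- and the vertex w^{i₀} outside V; since H is connected, a walk between
-- them inside H^w crosses from V to its complement along some edge.  In
-- case (b), the first p colours each meet V and each contains the vertex
-- w₀^i of the unoccupied copy H^{w₀}, which is outside V; since T is
-- connected, a walk in the layer of colour i gives a crossing edge.
-- The p edges obtained lie in p distinct copies (a) resp. p distinct
-- layers (b), so they are pairwise disjoint.

open import Defs hiding (sym)
open import Data.Nat using (ℕ; _≤_)
open import Data.Fin using (Fin; inject≤)
open import Data.Fin.Properties using (any?; all?; inject≤-injective)
open import Data.Bool using (Bool; true; false)
open import Data.Bool.Properties using (¬-not) renaming (_≟_ to _≟ᵇ_)
open import Data.Product using (∃; _×_; _,_; proj₁; proj₂)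
open import Data.Sum using (_⊎_; inj₁; inj₂)
open import Data.Empty using (⊥-elim)
open import Function.Definitions using (Injective)
open import Relation.Nullary using (¬_; yes; no)
open import Relation.Binary.PropositionalEquality using (_≡_; _≢_; refl; sym; trans; cong)

record CrossingEdge (G : Graph) (P : Fin (n G) → Bool) : Set where
  field
    inside   : Fin (n G)
    outside  : Fin (n G)
    adjacent : Adj G inside outside
    inside∈  : P inside ≡ true
    outside∉ : P outside ≡ false

crossing-edge : (G : Graph) (P : Fin (n G) → Bool) {a b : Fin (n G)} →
  Walk G a b → P a ≡ true → P b ≡ false → CrossingEdge G P
crossing-edge G P here a∈ b∉ with () ← trans (sym a∈) b∉
crossing-edge G P {a} (step {v = v} a~v walk) a∈ b∉ with P v in v∈?
... | true  = crossing-edge G P walk v∈? b∉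
... | false = record { inside = a ; outside = v ; adjacent = a~v
                     ; inside∈ = a∈ ; outside∉ = v∈? }

disjoint-by-label : {A L : Set} (label : A → L) {a b c d : A} {ℓ₁ ℓ₂ : L} →
  label a ≡ ℓ₁ → label b ≡ ℓ₁ → label c ≡ ℓ₂ → label d ≡ ℓ₂ → ℓ₁ ≢ ℓ₂ →
  Disjoint (a , b) (c , d)
disjoint-by-label label {ℓ₁ = ℓ₁} {ℓ₂} la lb lc ld ℓ₁≢ℓ₂ =
  separate la lc , separate la ld , separate lb lc , separate lb ld
  where
    separate : ∀ {x y} → label x ≡ ℓ₁ → label y ≡ ℓ₂ → x ≢ y
    separate lx ly x≡y = ℓ₁≢ℓ₂ (trans (sym lx) (trans (cong label x≡y) ly))

cross-matching-by-label : (T H : Graph) (V : VSub T H) {p : ℕ} {L : Set}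
  (label : VT T H → L) (ℓ : Fin p → L) → Injective _≡_ _≡_ ℓ →
  (e : Fin p → VT T H × VT T H) →
  (∀ k → label (proj₁ (e k)) ≡ ℓ k × label (proj₂ (e k)) ≡ ℓ k) →
  (∀ k → AdjTH T H (proj₁ (e k)) (proj₂ (e k))) →
  (∀ k → V (proj₁ (e k)) ≡ true) → (∀ k → V (proj₂ (e k)) ≡ false) →
  CrossMatching T H V p
cross-matching-by-label T H V label ℓ ℓ-inj e labelled adj in-V out-V =
  e , adj , in-V , (λ k x∈ → false≢true (trans (sym (out-V k)) x∈)) , disjoint
  where
    false≢true : false ≢ true
    false≢true ()
    disjoint : ∀ k l → k ≢ l → Disjoint (e k) (e l)
    disjoint k l k≢l =
      disjoint-by-label label (proj₁ (labelled k)) (proj₂ (labelled k))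
        (proj₁ (labelled l)) (proj₂ (labelled l)) (λ ℓk≡ℓl → k≢l (ℓ-inj ℓk≡ℓl))

row-empty-or-all-rows-hit : {a b : ℕ} (R : Fin a → Fin b → Bool) →
  (∃ λ i → ∀ w → R i w ≡ false) ⊎ (∀ i → ∃ λ w → R i w ≡ true)
row-empty-or-all-rows-hit R with any? (λ i → all? (λ w → R i w ≟ᵇ false))
... | yes empty-row = inj₁ empty-row
... | no no-empty-row = inj₂ hit
  where
    hit : ∀ i → ∃ λ w → R i w ≡ true
    hit i with any? (λ w → R i w ≟ᵇ true)
    ... | yes w-hit = w-hit
    ... | no  no-hit = ⊥-elim (no-empty-row (i , λ w → ¬-not (λ h → no-hit (w , h))))

matching-in-copies : (p : ℕ) (T H : Graph) → Connected H → (V : VSub T H) →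
  OCatLeast T H p V → (i₀ : Fin (n H)) → (∀ w → V (w , i₀) ≡ false) →
  CrossMatching T H V p
matching-in-copies p T H connH V (f , f-inj , occupied) i₀ i₀∉ =
  cross-matching-by-label T H V proj₁ f (λ {k} {l} → f-inj k l) e
    (λ _ → refl , refl) (λ k → inj₁ (refl , adjacent (edge k)))
    (λ k → inside∈ (edge k)) (λ k → outside∉ (edge k))
  where
    open CrossingEdge
    edge : ∀ k → CrossingEdge H (λ i → V (f k , i))
    edge k = crossing-edge H (λ i → V (f k , i))
      (connH (proj₁ (occupied k)) i₀) (proj₂ (occupied k)) (i₀∉ (f k))
    e : Fin p → VT T H × VT T H
    e k = (f k , inside (edge k)) , (f k , outside (edge k))

matching-along-layers : (p : ℕ) (T H : Graph) → Connected T → p ≤ n H →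
  (V : VSub T H) → (∀ i → ∃ λ w → V (w , i) ≡ true) →
  (w₀ : Fin (n T)) → ¬ InOC T H w₀ V → CrossMatching T H V p
matching-along-layers p T H connT p≤n V hit w₀ w₀∉ =
  cross-matching-by-label T H V proj₂ colour
    (λ {k} {l} → inject≤-injective p≤n p≤n k l) e
    (λ _ → refl , refl) (λ k → inj₂ (refl , adjacent (edge k)))
    (λ k → inside∈ (edge k)) (λ k → outside∉ (edge k))
  where
    open CrossingEdge
    colour : Fin p → Fin (n H)
    colour k = inject≤ k p≤n
    edge : ∀ k → CrossingEdge T (λ w → V (w , colour k))
    edge k = crossing-edge T (λ w → V (w , colour k))
      (connT (proj₁ (hit (colour k))) w₀) (proj₂ (hit (colour k)))
      (¬-not (λ h → w₀∉ (colour k , h)))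
    e : Fin p → VT T H × VT T H
    e k = (inside (edge k) , colour k) , (outside (edge k) , colour k)

lemma7 : (p : ℕ) → 1 ≤ p → (T H : Graph) → IsTree T → Connected H → p ≤ n H →
    (V : VSub T H) → OCatLeast T H p V → (∃ λ w → ¬ (InOC T H w V)) →
    CrossMatching T H V p
lemma7 p _ T H (connT , _) connH p≤n V occupied (w₀ , w₀∉)
  with row-empty-or-all-rows-hit (λ i w → V (w , i))
... | inj₁ (i₀ , i₀∉) = matching-in-copies p T H connH V occupied i₀ i₀∉
... | inj₂ hit        = matching-along-layers p T H connT p≤n V hit w₀ w₀∉
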